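{- For every integer $n\ge 3$, $e(3,n)=\left\lceil \tfrac{3}{2}(n-1)\right\rceil$; that is, the minimum number of edges of a connected $3^*$-dense graph on $n$ vertices is $\left\lceil \tfrac{3}{2}(n-1)\right\rceil$.
   Context: All graphs are finite and simple. For an edge $uv$ of a graph $G$, the edge multiplicity is $m_G(uv)=|N_G(u)\cap N_G(v)|$. For an integer $k\ge 2$, a graph $G$ is called $k$-dense if $G$ has no isolated vertices and every edge $uv$ of $G$ satisfies $m_G(uv)\ge k-2$. A graph is $k^*$-dense if it is $k$-dense but not $(k+1)$-dense. For positive integers $k,n$, $e(k,n)$ denotes the minimum number of edges of a connected graph on $n$ vertices that is $k^*$-dense. -}

module Defs where

open import Data.Nat using (ℕ; zero; suc; _+_; _*_; _∸_; _≤_; _<ᵇ_)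
open import Data.Nat.DivMod using (_/_)
open import Data.Fin using (Fin; toℕ) renaming (zero to fz; suc to fs)
open import Data.Bool using (Bool; true; false; T; _∧_; if_then_else_)
open import Data.Product using (Σ; ∃; _×_)
open import Relation.Nullary using (¬_)
open import Relation.Binary.PropositionalEquality using (_≡_)

record Graph (n : ℕ) : Set where
  field
    adj    : Fin n → Fin n → Bool
    sym    : ∀ u v → adj u v ≡ adj v u
    irrefl : ∀ u → adj u u ≡ false
open Graph public

count : {n : ℕ} → (Fin n → Bool) → ℕ
count {zero}  p = 0
count {suc n} p = (if p fz then 1 else 0) + count (λ i → p (fs i))

sumFin : {n : ℕ} → (Fin n → ℕ) → ℕ
sumFin {zero}  f = 0
sumFin {suc n} f = f fz + sumFin (λ i → f (fs i))

edgeCount : {n : ℕ} → Graph n → ℕ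
edgeCount G = sumFin (λ u → count (λ v → (toℕ u <ᵇ toℕ v) ∧ adj G u v))

mult : {n : ℕ} → Graph n → Fin n → Fin n → ℕ
mult G u v = count (λ w → adj G u w ∧ adj G v w)

data Walk {n : ℕ} (G : Graph n) : Fin n → Fin n → Set where
  here : ∀ {u} → Walk G u u
  step : ∀ {u w v} → T (adj G u w) → Walk G w v → Walk G u v

Connected : {n : ℕ} → Graph n → Set
Connected G = ∀ u v → Walk G u v

NoIsolated : {n : ℕ} → Graph n → Set
NoIsolated G = ∀ u → ∃ λ v → T (adj G u v)

Dense : {n : ℕ} → ℕ → Graph n → Set
Dense k G = NoIsolated G × (∀ u v → T (adj G u v) → k ∸ 2 ≤ mult G u v)

DenseStar : {n : ℕ} → ℕ → Graph n → Set
DenseStar k G = Dense k G × ¬ Dense (suc k) G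

-- ⌈ 3 (n-1) / 2 ⌉ = ⌊ (3 (n-1) + 1) / 2 ⌋
ceil3half : ℕ → ℕ
ceil3half n = (3 * (n ∸ 1) + 1) / 2

module Submission where

-- For a graph with at least two vertices and no isolated vertex (in particular a
-- connected one), being 3-dense means exactly that every edge lies in a triangle.
--
-- Let G be connected on n vertices with every edge in a triangle.
-- Grow a vertex set S from {0}, keeping the invariant 3|S| ≤ 2·e(G[S]) + 3.  While
-- S ≠ V(G), connectivity gives an edge uv with u ∈ S, v ∉ S, and a triangle uvw.
-- If w ∈ S, adding v adds at least two edges; if w ∉ S, adding v and then w adds at
-- least 1 + 2 edges.  Either way the invariant survives, so at the end
-- 3n ≤ 2e(G) + 3, i.e. e(G) ≥ ⌈3(n-1)/2⌉.  Here 2·e(G[S]) is the number of ordered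
-- adjacent pairs inside S, which changes by exactly 2·deg_S(x) when x is added.
--
-- Every graph used is built from one vertex by adding vertices with
-- prescribed neighbourhoods.  The triangle chain C_j (j triangles, each sharing one
-- vertex with the previous one) has 2j + 1 vertices and 3j edges; adding to C_j
-- (j ≥ 1) an "ear" (a vertex joined to the two ends of an edge) gives 2j + 2
-- vertices and 3j + 2 edges.  Each graph ends with an ear, whose two edges lie in
-- only one triangle, so it is not 4-dense.

open import Defs hiding (sym)
open import Data.Nat using (ℕ; zero; suc; _+_; _*_; _/_; _≤_; _<_; _<ᵇ_; z≤n; s≤s)
open import Data.Nat.Properties
  using ( +-0-commutativeMonoid; +-identityʳ; +-suc; +-assoc; +-comm; *-suc; *-distribˡ-+
        ; ≤-refl; ≤-reflexive; ≤-trans; ≤-antisym; <-≤-trans; ≤-<-trans; <-trans; ≰⇒>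
        ; +-mono-≤; +-monoˡ-≤; +-monoʳ-≤; *-monoʳ-≤; +-cancelʳ-≤; m≤m+n; m≤n+m
        ; ≤-pred; m<m+n; n≤1+n; <-cmp; <⇒<ᵇ; <ᵇ⇒<; _≤?_
        ; module ≤-Reasoning )
open import Data.Nat.DivMod using (m/n≡1+[m∸n]/n; m<n⇒m/n≡0; /-monoˡ-≤)
open import Data.Nat.Tactic.RingSolver using (solve-∀)
open import Data.Fin using (Fin; toℕ) renaming (zero to fz; suc to fs)
open import Data.Fin.Properties using (_≟_; toℕ-injective)
open import Data.Bool using (Bool; true; false; T; _∧_; _∨_; if_then_else_)
open import Data.Bool.Properties using (T-≡; T-∧; ∨-identityʳ; ∨-zeroʳ; ∧-zeroʳ)
open import Data.Unit using (tt)
open import Data.Empty using (⊥-elim)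
open import Data.Product using (Σ; ∃; _×_; _,_)
open import Data.Sum using (_⊎_; inj₁; inj₂)
open import Function.Bundles using (Equivalence)
open import Relation.Nullary using (¬_; yes; no; does)
open import Relation.Binary using (tri<; tri≈; tri>)
open import Relation.Binary.PropositionalEquality
  using (_≡_; _≢_; refl; sym; trans; cong; cong₂; subst; module ≡-Reasoning)
open import Algebra.Properties.CommutativeMonoid.Sum +-0-commutativeMonoid
  using (sum; sum-cong-≗; ∑-distrib-+; ∑-comm; sum-replicate-zero)

ind : Bool → ℕ
ind b = if b then 1 else 0

ind≤1 : ∀ b → ind b ≤ 1
ind≤1 true  = ≤-refl
ind≤1 false = z≤n

sumFin≡sum : ∀ {n} (f : Fin n → ℕ) → sumFin f ≡ sum f
sumFin≡sum {zero}  f = refl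
sumFin≡sum {suc n} f = cong (f fz +_) (sumFin≡sum (λ i → f (fs i)))

count≡sum : ∀ {n} (p : Fin n → Bool) → count p ≡ sum (λ i → ind (p i))
count≡sum {zero}  p = refl
count≡sum {suc n} p = cong (ind (p fz) +_) (count≡sum (λ i → p (fs i)))

count-false : ∀ n → count {n} (λ _ → false) ≡ 0
count-false zero    = refl
count-false (suc n) = count-false n

∑∑-distrib-+ : ∀ {m n} (f g : Fin m → Fin n → ℕ) →
  sum (λ u → sum (λ v → f u v + g u v)) ≡ sum (λ u → sum (f u)) + sum (λ u → sum (g u))
∑∑-distrib-+ f g =
  trans (sum-cong-≗ (λ u → ∑-distrib-+ (f u) (g u))) (∑-distrib-+ (λ u → sum (f u)) (λ u → sum (g u)))

sum-mono : ∀ {n} {f g : Fin n → ℕ} → (∀ i → f i ≤ g i) → sum f ≤ sum g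
sum-mono {zero}  f≤g = z≤n
sum-mono {suc n} f≤g = +-mono-≤ (f≤g fz) (sum-mono (λ i → f≤g (fs i)))

sum-point : ∀ {n} (x : Fin n) (g : Fin n → ℕ) →
  sum (λ u → if does (x ≟ u) then g u else 0) ≡ g x
sum-point {suc n} fz     g = trans (cong (g fz +_) (sum-replicate-zero n)) (+-identityʳ (g fz))
sum-point {suc n} (fs x) g = sum-point x (λ i → g (fs i))

sum-≥-term : ∀ {n} (a : Fin n) (f : Fin n → ℕ) → f a ≤ sum f
sum-≥-term fz     f = m≤m+n (f fz) _
sum-≥-term (fs a) f = ≤-trans (sum-≥-term a (λ i → f (fs i))) (m≤n+m _ (f fz))

sum-≥-pair : ∀ {n} (a b : Fin n) (f : Fin n → ℕ) → a ≢ b → f a + f b ≤ sum f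
sum-≥-pair fz     fz     f a≢b = ⊥-elim (a≢b refl)
sum-≥-pair fz     (fs b) f _   = +-monoʳ-≤ (f fz) (sum-≥-term b (λ i → f (fs i)))
sum-≥-pair (fs a) fz     f _   =
  subst (_≤ sum f) (+-comm (f fz) (f (fs a))) (+-monoʳ-≤ (f fz) (sum-≥-term a (λ i → f (fs i))))
sum-≥-pair (fs a) (fs b) f a≢b =
  ≤-trans (sum-≥-pair a b (λ i → f (fs i)) (λ a≡b → a≢b (cong fs a≡b))) (m≤n+m _ (f fz))

missing-point : ∀ {n} (S : Fin n → Bool) → sum (λ i → ind (S i)) < n → ∃ λ x → S x ≡ false
missing-point {suc n} S small with S fz in S0
... | false = fz , S0
... | true  with missing-point (λ i → S (fs i)) (≤-pred small)
...   | x , Sx = fs x , Sx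

count-witness : ∀ {n} (p : Fin n → Bool) → 1 ≤ count p → ∃ λ w → T (p w)
count-witness {suc n} p pos with p fz in p0
... | true  = fz , Equivalence.from T-≡ p0
... | false = let (w , pw) = count-witness (λ i → p (fs i)) pos in fs w , pw

count-≥-witness : ∀ {n} (p : Fin n → Bool) (w : Fin n) → T (p w) → 1 ≤ count p
count-≥-witness p w pw = subst (1 ≤_) (sym (count≡sum p))
  (≤-trans (≤-reflexive (cong ind (sym (Equivalence.to T-≡ pw)))) (sum-≥-term w (λ i → ind (p i))))

adj-sym : ∀ {n} (G : Graph n) {u v} → T (adj G u v) → T (adj G v u)
adj-sym G {u} {v} = subst T (Graph.sym G u v)

adj-distinct : ∀ {n} (G : Graph n) {u v} → T (adj G u v) → u ≢ v
adj-distinct G {u} uv refl = subst T (irrefl G u) uv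

_++ʷ_ : ∀ {n} {G : Graph n} {a b c} → Walk G a b → Walk G b c → Walk G a c
here      ++ʷ q = q
step t p  ++ʷ q = step t (p ++ʷ q)

reverseʷ : ∀ {n} {G : Graph n} {a b} → Walk G a b → Walk G b a
reverseʷ         here       = here
reverseʷ {G = G} (step t p) = reverseʷ p ++ʷ step (adj-sym G t) here

hub-connected : ∀ {n} (G : Graph n) (c : Fin n) → (∀ u → Walk G u c) → Connected G
hub-connected G c toHub u v = toHub u ++ʷ reverseʷ (toHub v)

mapʷ : ∀ {m n} {G : Graph m} {H : Graph n} (f : Fin m → Fin n) →
  (∀ {u v} → T (adj G u v) → T (adj H (f u) (f v))) → ∀ {a b} → Walk G a b → Walk H (f a) (f b)
mapʷ f hom here       = here
mapʷ f hom (step t p) = step (hom t) (mapʷ f hom p)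

record CrossingEdge {n} (G : Graph n) (S : Fin n → Bool) : Set where
  constructor crossing
  field
    inner outer : Fin n
    inner∈S     : S inner ≡ true
    outer∉S     : S outer ≡ false
    edge        : T (adj G inner outer)

crossing-edge : ∀ {n} {G : Graph n} (S : Fin n → Bool) {a b} →
  Walk G a b → S a ≡ true → S b ≡ false → CrossingEdge G S
crossing-edge S here a∈S a∉S with () ← trans (sym a∈S) a∉S
crossing-edge S (step {u} {w} t p) u∈S b∉S with S w in Sw
... | false = crossing u w u∈S Sw t
... | true  = crossing-edge S p Sw b∉S

connected⇒no-isolated : ∀ {k} (G : Graph (suc (suc k))) → Connected G → NoIsolated G
connected⇒no-isolated G conn u = first-step (conn u (other u)) (other-distinct u)
  where
  other : Fin _ → Fin _
  other fz     = fs fz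
  other (fs _) = fz
  other-distinct : ∀ u → u ≢ other u
  other-distinct fz     ()
  other-distinct (fs _) ()
  first-step : ∀ {u v} → Walk G u v → u ≢ v → ∃ λ w → T (adj G u w)
  first-step here           u≢u = ⊥-elim (u≢u refl)
  first-step (step {w = w} t _) _ = w , t

InTriangle : ∀ {n} → Graph n → Fin n → Fin n → Set
InTriangle G u v = ∃ λ w → T (adj G u w) × T (adj G v w)

Triangular : ∀ {n} → Graph n → Set
Triangular G = ∀ u v → T (adj G u v) → InTriangle G u v

-- m_G(uv) ≥ 1 says precisely that uv has a common neighbour.
dense⇒triangular : ∀ {n} (G : Graph n) → Dense 3 G → Triangular G
dense⇒triangular G (_ , mult≥1) u v uv =
  let (w , uw∧vw) = count-witness _ (mult≥1 u v uv) in w , Equivalence.to T-∧ uw∧vw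

triangular⇒dense : ∀ {k} (G : Graph (suc (suc k))) → Connected G → Triangular G → Dense 3 G
triangular⇒dense G conn tri = connected⇒no-isolated G conn , mult≥1
  where
  mult≥1 : ∀ u v → T (adj G u v) → 1 ≤ mult G u v
  mult≥1 u v uv = let (w , uw , vw) = tri u v uv in
    count-≥-witness (λ x → adj G u x ∧ adj G v x) w (Equivalence.from T-∧ (uw , vw))

<ᵇ-true : ∀ {a b} → a < b → (a <ᵇ b) ≡ true
<ᵇ-true a<b = Equivalence.to T-≡ (<⇒<ᵇ a<b)

<ᵇ-false : ∀ {a b} → ¬ a < b → (a <ᵇ b) ≡ false
<ᵇ-false {a} {b} a≮b with a <ᵇ b in ab
... | true  = ⊥-elim (a≮b (<ᵇ⇒< a b (Equivalence.from T-≡ ab)))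
... | false = refl

module VertexSets {n : ℕ} (G : Graph n) where

  VertexSet : Set
  VertexSet = Fin n → Bool

  size : VertexSet → ℕ
  size S = sum (λ v → ind (S v))

  degIn : VertexSet → Fin n → ℕ
  degIn S x = sum (λ y → ind (S y ∧ adj G x y))

  -- The number of ordered adjacent pairs inside S, i.e. 2·e(G[S]).
  pairsIn : VertexSet → ℕ
  pairsIn S = sum (λ u → sum (λ v → ind (S u ∧ S v ∧ adj G u v)))

  insert : VertexSet → Fin n → VertexSet
  insert S x y = S y ∨ does (x ≟ y)

  insert-keeps : ∀ (S : VertexSet) x {y} → S y ≡ true → insert S x y ≡ true
  insert-keeps S x S∋y rewrite S∋y = refl

  insert-new : ∀ (S : VertexSet) x → insert S x x ≡ true
  insert-new S x with x ≟ x
  ... | yes _   = ∨-zeroʳ (S x)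
  ... | no  x≢x = ⊥-elim (x≢x refl)

  insert-outside : ∀ (S : VertexSet) x {y} → S y ≡ false → x ≢ y → insert S x y ≡ false
  insert-outside S x {y} y∉S x≢y with x ≟ y
  ... | yes x≡y = ⊥-elim (x≢y x≡y)
  ... | no  _   rewrite y∉S = refl

  size-insert : ∀ (S : VertexSet) x → S x ≡ false → size (insert S x) ≡ size S + 1
  size-insert S x x∉S = begin
    size (insert S x)
      ≡⟨ sum-cong-≗ pointwise ⟩
    sum (λ y → ind (S y) + (if does (x ≟ y) then 1 else 0))
      ≡⟨ ∑-distrib-+ {n} _ _ ⟩
    size S + sum (λ y → if does (x ≟ y) then 1 else 0)
      ≡⟨ cong (size S +_) (sum-point x (λ _ → 1)) ⟩
    size S + 1
      ∎
    where
    open ≡-Reasoning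
    pointwise : ∀ y → ind (insert S x y) ≡ ind (S y) + (if does (x ≟ y) then 1 else 0)
    pointwise y with x ≟ y
    ... | yes refl rewrite x∉S = refl
    ... | no  _    rewrite ∨-identityʳ (S y) = sym (+-identityʳ (ind (S y)))

  size-grows : ∀ (S : VertexSet) x → S x ≡ false → size S < size (insert S x)
  size-grows S x x∉S = subst (size S <_) (sym (size-insert S x x∉S)) (m<m+n (size S) ≤-refl)

  -- Adding x to S creates the ordered pairs (x, y) and (y, x) for the neighbours y ∈ S.
  pairs-insert-pointwise : ∀ (S : VertexSet) x → S x ≡ false → ∀ u v →
    ind (insert S x u ∧ insert S x v ∧ adj G u v)
      ≡ ind (S u ∧ S v ∧ adj G u v)
        + ((if does (x ≟ u) then ind (S v ∧ adj G x v) else 0)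
           + (if does (x ≟ v) then ind (S u ∧ adj G x u) else 0))
  pairs-insert-pointwise S x x∉S u v with x ≟ u | x ≟ v
  ... | yes refl | yes refl rewrite x∉S | irrefl G x = refl
  ... | yes refl | no  _    rewrite x∉S | ∨-identityʳ (S v) = sym (+-identityʳ (ind (S v ∧ adj G x v)))
  ... | no  _    | yes refl rewrite x∉S | ∨-identityʳ (S u) | ∧-zeroʳ (S u) | Graph.sym G u x = refl
  ... | no  _    | no  _    rewrite ∨-identityʳ (S u) | ∨-identityʳ (S v) =
    sym (+-identityʳ (ind (S u ∧ S v ∧ adj G u v)))

  pairsIn-insert : ∀ (S : VertexSet) x → S x ≡ false →
    pairsIn (insert S x) ≡ pairsIn S + (degIn S x + degIn S x)
  pairsIn-insert S x x∉S = begin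
    pairsIn (insert S x)
      ≡⟨ sum-cong-≗ (λ u → sum-cong-≗ (pairs-insert-pointwise S x x∉S u)) ⟩
    sum (λ u → sum (λ v → inside u v + (new-first u v + new-second u v)))
      ≡⟨ ∑∑-distrib-+ inside (λ u v → new-first u v + new-second u v) ⟩
    pairsIn S + sum (λ u → sum (λ v → new-first u v + new-second u v))
      ≡⟨ cong (pairsIn S +_) (∑∑-distrib-+ new-first new-second) ⟩
    pairsIn S + (sum (λ u → sum (new-first u)) + sum (λ u → sum (new-second u)))
      ≡⟨ cong (pairsIn S +_) (cong₂ _+_ (trans (∑-comm new-first) first-is-deg) second-is-deg) ⟩
    pairsIn S + (degIn S x + degIn S x)
      ∎
    where
    open ≡-Reasoning
    inside new-first new-second : Fin n → Fin n → ℕ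
    inside     u v = ind (S u ∧ S v ∧ adj G u v)
    new-first  u v = if does (x ≟ u) then ind (S v ∧ adj G x v) else 0
    new-second u v = if does (x ≟ v) then ind (S u ∧ adj G x u) else 0
    first-is-deg : sum (λ v → sum (λ u → new-first u v)) ≡ degIn S x
    first-is-deg = sum-cong-≗ (λ v → sum-point x (λ _ → ind (S v ∧ adj G x v)))
    second-is-deg : sum (λ u → sum (new-second u)) ≡ degIn S x
    second-is-deg = sum-cong-≗ (λ u → sum-point x (λ _ → ind (S u ∧ adj G x u)))

  neighbour-counts : ∀ (S : VertexSet) x {a} → S a ≡ true → T (adj G x a) →
    ind (S a ∧ adj G x a) ≡ 1
  neighbour-counts S x S∋a xa rewrite S∋a | Equivalence.to T-≡ xa = refl

  degIn-≥1 : ∀ (S : VertexSet) x {a} → S a ≡ true → T (adj G x a) → 1 ≤ degIn S x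
  degIn-≥1 S x {a} S∋a xa =
    subst (_≤ degIn S x) (neighbour-counts S x S∋a xa) (sum-≥-term a (λ y → ind (S y ∧ adj G x y)))

  degIn-≥2 : ∀ (S : VertexSet) x {a b} → a ≢ b →
    S a ≡ true → T (adj G x a) → S b ≡ true → T (adj G x b) → 2 ≤ degIn S x
  degIn-≥2 S x {a} {b} a≢b S∋a xa S∋b xb =
    subst (_≤ degIn S x) (cong₂ _+_ (neighbour-counts S x S∋a xa) (neighbour-counts S x S∋b xb))
          (sum-≥-pair a b (λ y → ind (S y ∧ adj G x y)) a≢b)

  everything : VertexSet
  everything _ = true

  pairsIn-≤ : ∀ (S : VertexSet) → pairsIn S ≤ pairsIn everything
  pairsIn-≤ S = sum-mono (λ u → sum-mono (λ v → restrict (S u) (S v) (adj G u v)))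
    where
    restrict : ∀ a b c → ind (a ∧ b ∧ c) ≤ ind c
    restrict true  true  c = ≤-refl
    restrict true  false c = z≤n
    restrict false b     c = z≤n

  -- Each edge uv is seen once as the forward pair (u, v) with u < v and once as
  -- the backward pair (v, u): pairsIn V(G) = 2e(G).
  pairsIn-everything : pairsIn everything ≡ edgeCount G + edgeCount G
  pairsIn-everything = begin
    pairsIn everything
      ≡⟨ sum-cong-≗ (λ u → sum-cong-≗ (split u)) ⟩
    sum (λ u → sum (λ v → forward u v + forward v u))
      ≡⟨ ∑∑-distrib-+ forward (λ u v → forward v u) ⟩
    total + sum (λ u → sum (λ v → forward v u))
      ≡⟨ cong (total +_) (∑-comm (λ u v → forward v u)) ⟩
    total + total
      ≡⟨ cong₂ _+_ total≡edges total≡edges ⟩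
    edgeCount G + edgeCount G
      ∎
    where
    open ≡-Reasoning
    forward : Fin n → Fin n → ℕ
    forward u v = ind ((toℕ u <ᵇ toℕ v) ∧ adj G u v)
    total : ℕ
    total = sum (λ u → sum (forward u))
    total≡edges : total ≡ edgeCount G
    total≡edges = sym (trans (sumFin≡sum {n} _)
      (sum-cong-≗ {n} (λ u → count≡sum (λ v → (toℕ u <ᵇ toℕ v) ∧ adj G u v))))
    split : ∀ u v → ind (adj G u v) ≡ forward u v + forward v u
    split u v with <-cmp (toℕ u) (toℕ v)
    ... | tri< u<v _ v≮u rewrite <ᵇ-true u<v | <ᵇ-false v≮u = sym (+-identityʳ _)
    ... | tri> u≮v _ v<u rewrite <ᵇ-false u≮v | <ᵇ-true v<u = cong ind (Graph.sym G u v)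
    ... | tri≈ u≮v u≡v _ rewrite toℕ-injective u≡v | <ᵇ-false u≮v | irrefl G v = refl

module LowerBound {m : ℕ} (G : Graph (suc m)) (conn : Connected G) (tri : Triangular G) where
  open VertexSets G

  Budget : ℕ → VertexSet → Set
  Budget c S = 3 * size S ≤ pairsIn S + c

  -- Adding x ∉ S raises 3|S| by 3 and pairsIn S by 2·deg_S(x) ≥ 2k, so the
  -- slack may move from c to c′ as long as c + 3 ≤ 2k + c′.
  insert-budget : ∀ {c c′ k} (S : VertexSet) x → S x ≡ false → k ≤ degIn S x →
    c + 3 ≤ k + k + c′ → Budget c S → Budget c′ (insert S x)
  insert-budget {c} {c′} {k} S x x∉S k≤deg affordable budget = begin
    3 * size (insert S x)    ≡⟨ cong (3 *_) (size-insert S x x∉S) ⟩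
    3 * (size S + 1)         ≡⟨ *-distribˡ-+ 3 (size S) 1 ⟩
    3 * size S + 3           ≤⟨ +-monoˡ-≤ 3 budget ⟩
    pairsIn S + c + 3        ≡⟨ +-assoc (pairsIn S) c 3 ⟩
    pairsIn S + (c + 3)      ≤⟨ +-monoʳ-≤ (pairsIn S) paid ⟩
    pairsIn S + (d + d + c′) ≡⟨ sym (+-assoc (pairsIn S) (d + d) c′) ⟩
    pairsIn S + (d + d) + c′ ≡⟨ cong (_+ c′) (sym (pairsIn-insert S x x∉S)) ⟩
    pairsIn (insert S x) + c′ ∎
    where
    open ≤-Reasoning
    d : ℕ
    d = degIn S x
    paid : c + 3 ≤ d + d + c′
    paid = ≤-trans affordable (+-monoˡ-≤ c′ (+-mono-≤ k≤deg k≤deg))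

  record Good (S : VertexSet) : Set where
    constructor good
    field
      root   : S fz ≡ true
      budget : Budget 3 S

  start : VertexSet
  start = insert (λ _ → false) fz

  start-good : Good start
  start-good = good refl (insert-budget (λ _ → false) fz refl z≤n ≤-refl empty-budget)
    where
    empty-budget : Budget 0 (λ _ → false)
    empty-budget = subst (λ s → 3 * s ≤ pairsIn (λ _ → false) + 0)
                         (sym (sum-replicate-zero (suc m))) z≤n

  extend : ∀ (S : VertexSet) → Good S → size S < suc m → Σ VertexSet λ S′ → Good S′ × size S < size S′
  extend S (good root budget) small
    with missing-point S small
  ... | x , x∉S
    with crossing-edge S (conn fz x) root x∉S
  ... | crossing u v u∈S v∉S uv
    with tri u v uv
  ... | w , uw , vw
    with S w in Sw
  -- w ∈ S: v has the two neighbours u, w in S.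
  ... | true  = insert S v , good (insert-keeps S v root) budget′ , size-grows S v v∉S
    where
    budget′ : Budget 3 (insert S v)
    budget′ = insert-budget S v v∉S
      (degIn-≥2 S v (adj-distinct G uw) u∈S (adj-sym G uv) Sw vw) (n≤1+n 6) budget
  -- w ∉ S: add v (neighbour u) with slack 4, then w (neighbours u, v) back to slack 3.
  ... | false = S₂ , good (insert-keeps S₁ w (insert-keeps S v root)) budget₂ , grows
    where
    S₁ S₂ : VertexSet
    S₁ = insert S v
    S₂ = insert S₁ w
    w∉S₁ : S₁ w ≡ false
    w∉S₁ = insert-outside S v Sw (adj-distinct G vw)
    budget₁ : Budget 4 S₁
    budget₁ = insert-budget S v v∉S (degIn-≥1 S v u∈S (adj-sym G uv)) ≤-refl budget
    budget₂ : Budget 3 S₂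
    budget₂ = insert-budget S₁ w w∉S₁
      (degIn-≥2 S₁ w (adj-distinct G uv) (insert-keeps S v u∈S) (adj-sym G uw)
                     (insert-new S v) (adj-sym G vw))
      ≤-refl budget₁
    grows : size S < size S₂
    grows = <-trans (size-grows S v v∉S) (size-grows S₁ w w∉S₁)

  grow : ∀ k → k ≤ suc m → Σ VertexSet λ S → Good S × k ≤ size S
  grow zero    _    = start , start-good , z≤n
  grow (suc k) k<n with grow k (≤-trans (n≤1+n k) k<n)
  ... | S , goodS , k≤size with suc k ≤? size S
  ...   | yes k<size = S , goodS , k<size
  ...   | no  k≮size with extend S goodS (<-≤-trans (≰⇒> k≮size) k<n)
  ...     | S′ , goodS′ , size< = S′ , goodS′ , ≤-<-trans k≤size size<

  lower-bound : 3 * m ≤ edgeCount G + edgeCount G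
  lower-bound with grow (suc m) ≤-refl
  ... | S , good _ budget , full = +-cancelʳ-≤ 3 (3 * m) (edgeCount G + edgeCount G) (begin
    3 * m + 3                       ≡⟨ +-comm (3 * m) 3 ⟩
    3 + 3 * m                       ≡⟨ sym (*-suc 3 m) ⟩
    3 * suc m                       ≤⟨ *-monoʳ-≤ 3 full ⟩
    3 * size S                      ≤⟨ budget ⟩
    pairsIn S + 3                   ≤⟨ +-monoˡ-≤ 3 (pairsIn-≤ S) ⟩
    pairsIn everything + 3          ≡⟨ cong (_+ 3) pairsIn-everything ⟩
    edgeCount G + edgeCount G + 3   ∎)
    where open ≤-Reasoning

-- Arithmetic of ceil3half n = ⌊(3(n-1) + 1)/2⌋ = ⌈3(n-1)/2⌉, based on
-- ⌊(2e + r)/2⌋ = e for r ∈ {0, 1}.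
half-double : ∀ e {r} → r < 2 → (e + e + r) / 2 ≡ e
half-double zero    r<2 = m<n⇒m/n≡0 r<2
half-double (suc e) {r} r<2 = begin
  (suc e + suc e + r) / 2   ≡⟨ cong (λ t → (suc t + r) / 2) (+-suc e e) ⟩
  (2 + (e + e + r)) / 2     ≡⟨ m/n≡1+[m∸n]/n {2 + (e + e + r)} (s≤s (s≤s z≤n)) ⟩
  suc ((e + e + r) / 2)     ≡⟨ cong suc (half-double e r<2) ⟩
  suc e                     ∎
  where open ≡-Reasoning

ceil3half-≤ : ∀ {m e} → 3 * m ≤ e + e → ceil3half (suc m) ≤ e
ceil3half-≤ {m} {e} 3m≤2e =
  ≤-trans (/-monoˡ-≤ {3 * m + 1} 2 (+-monoˡ-≤ 1 3m≤2e)) (≤-reflexive (half-double e (s≤s (s≤s z≤n))))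

ceil3half-exact : ∀ {m e} → 3 * m ≤ e + e → e + e ≤ 3 * m + 1 → ceil3half (suc m) ≡ e
ceil3half-exact {m} {e} 3m≤2e 2e≤3m+1 = ≤-antisym (ceil3half-≤ {m} 3m≤2e) e≤ceil
  where
  e≤ceil : e ≤ ceil3half (suc m)
  e≤ceil = ≤-trans (≤-reflexive (sym (half-double e (s≤s z≤n))))
                   (/-monoˡ-≤ {e + e + 0} 2 (≤-trans (≤-reflexive (+-identityʳ (e + e))) 2e≤3m+1))

-- 2j, by a recursion that exposes the successors.
twice : ℕ → ℕ
twice zero    = zero
twice (suc j) = suc (suc (twice j))

twice≡+ : ∀ j → twice j ≡ j + j
twice≡+ zero    = refl
twice≡+ (suc j) = cong suc (trans (cong suc (twice≡+ j)) (sym (+-suc j j)))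

parity : ∀ m → (∃ λ j → m ≡ twice j) ⊎ (∃ λ j → m ≡ suc (twice j))
parity zero    = inj₁ (zero , refl)
parity (suc m) with parity m
... | inj₁ (j , m≡2j)   = inj₂ (j , cong suc m≡2j)
... | inj₂ (j , m≡2j+1) = inj₁ (suc j , cong suc m≡2j+1)

-- The new vertex is 0, joined to the vertices of N; old vertex i becomes i + 1.
addVertexAdj : ∀ {n} → Graph n → (Fin n → Bool) → Fin (suc n) → Fin (suc n) → Bool
addVertexAdj H N fz     fz     = false
addVertexAdj H N fz     (fs j) = N j
addVertexAdj H N (fs i) fz     = N i
addVertexAdj H N (fs i) (fs j) = adj H i j

addVertex : ∀ {n} → Graph n → (Fin n → Bool) → Graph (suc n)
addVertex {n} H N = record { adj = addVertexAdj H N ; sym = symmetric ; irrefl = loopless }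
  where
  symmetric : ∀ u v → addVertexAdj H N u v ≡ addVertexAdj H N v u
  symmetric fz     fz     = refl
  symmetric fz     (fs j) = refl
  symmetric (fs i) fz     = refl
  symmetric (fs i) (fs j) = Graph.sym H i j
  loopless : ∀ u → addVertexAdj H N u u ≡ false
  loopless fz     = refl
  loopless (fs i) = irrefl H i

addVertex-edgeCount : ∀ {n} (H : Graph n) N →
  edgeCount (addVertex H N) ≡ count N + edgeCount H
addVertex-edgeCount H N = refl

addVertex-connected : ∀ {n} (H : Graph n) N {c} →
  Connected H → T (N c) → Connected (addVertex H N)
addVertex-connected H N {c} conn Nc = hub-connected (addVertex H N) (fs c) toHub
  where
  toHub : ∀ u → Walk (addVertex H N) u (fs c)
  toHub fz     = step Nc here
  toHub (fs i) = mapʷ fs (λ uv → uv) (conn i c)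

lift-triangle : ∀ {n} {H : Graph n} {N u v} →
  InTriangle H u v → InTriangle (addVertex H N) (fs u) (fs v)
lift-triangle (w , uw , vw) = fs w , uw , vw

-- Every edge of H + v lies in a triangle provided each old edge does so in H or
-- has both ends in N (then v completes it), and each neighbour of v has a
-- neighbour in N.
addVertex-triangular : ∀ {n} (H : Graph n) N →
  (∀ u v → T (adj H u v) → InTriangle H u v ⊎ (T (N u) × T (N v))) →
  (∀ c → T (N c) → ∃ λ w → T (N w) × T (adj H c w)) →
  Triangular (addVertex H N)
addVertex-triangular H N old new fz     (fs c) Nc = let (w , Nw , cw) = new c Nc in fs w , Nw , cw
addVertex-triangular H N old new (fs c) fz     Nc = let (w , Nw , cw) = new c Nc in fs w , cw , Nw
addVertex-triangular H N old new (fs u) (fs v) uv with old u v uv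
... | inj₁ triangle   = lift-triangle triangle
... | inj₂ (Nu , Nv)  = fz , Nu , Nv

first : ∀ {k} → Fin (suc k) → Bool
first fz     = true
first (fs _) = false

firstTwo : ∀ {k} → Fin (suc (suc k)) → Bool
firstTwo fz          = true
firstTwo (fs fz)     = true
firstTwo (fs (fs _)) = false

count-first : ∀ k → count (first {k}) ≡ 1
count-first k = cong suc (count-false k)

count-firstTwo : ∀ k → count (firstTwo {k}) ≡ 2
count-firstTwo k = cong (2 +_) (count-false k)

pendant : ∀ {k} → Graph (suc k) → Graph (suc (suc k))
pendant H = addVertex H first

ear : ∀ {k} → Graph (suc (suc k)) → Graph (suc (suc (suc k)))
ear H = addVertex H firstTwo

firstTwo-closed : ∀ {k} (H : Graph (suc (suc k))) → T (adj H fz (fs fz)) →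
  ∀ c → T (firstTwo c) → ∃ λ w → T (firstTwo w) × T (adj H c w)
firstTwo-closed H e01 fz          _ = fs fz , _ , e01
firstTwo-closed H e01 (fs fz)     _ = fz , _ , adj-sym H e01

pendant-edges : ∀ {k} (H : Graph (suc k)) → Triangular H →
  ∀ u v → T (adj (pendant H) u v) →
  InTriangle (pendant H) u v ⊎ (T (firstTwo u) × T (firstTwo v))
pendant-edges H tri fz     (fs fz) _  = inj₂ (_ , _)
pendant-edges H tri (fs fz) fz     _  = inj₂ (_ , _)
pendant-edges H tri (fs u) (fs v) uv = inj₁ (lift-triangle (tri u v uv))

-- The ear edge 0–1 has the single common neighbour 2, so an ear extension is not 4-dense.
ear-not-4-dense : ∀ {k} (H : Graph (suc (suc k))) → ¬ Dense 4 (ear H)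
ear-not-4-dense {k} H (_ , dense) = one-common-neighbour (dense fz (fs fz) _)
  where
  one-common-neighbour : ¬ (2 ≤ mult (ear H) fz (fs fz))
  one-common-neighbour 2≤mult
    rewrite irrefl H fz | count-false k | +-identityʳ (ind (adj H fz (fs fz)))
    with s≤s () ← ≤-trans 2≤mult (ind≤1 (adj H fz (fs fz)))

K₁ : Graph 1
K₁ = record { adj = λ _ _ → false ; sym = λ _ _ → refl ; irrefl = λ _ → refl }

-- The triangle chain C_j: C_{j+1} hangs a pendant vertex on vertex 0 of C_j and closes
-- it into a triangle with an ear, so vertices 0 and 1 of C_{j+1} are adjacent.
triangleChain : ∀ j → Graph (suc (twice j))
triangleChain zero    = K₁
triangleChain (suc j) = ear (pendant (triangleChain j))

triangleChain-connected : ∀ j → Connected (triangleChain j)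
triangleChain-connected zero    fz fz = here
triangleChain-connected (suc j) =
  addVertex-connected _ firstTwo {fz} (addVertex-connected _ first {fz} (triangleChain-connected j) tt) tt

triangleChain-triangular : ∀ j → Triangular (triangleChain j)
triangleChain-triangular zero    _ _ ()
triangleChain-triangular (suc j) =
  addVertex-triangular _ firstTwo (pendant-edges _ (triangleChain-triangular j))
                                  (firstTwo-closed (pendant (triangleChain j)) tt)

triangleChain-edges : ∀ j → edgeCount (triangleChain j) ≡ 3 * j
triangleChain-edges zero    = refl
triangleChain-edges (suc j) = begin
  edgeCount (ear (pendant W))
    ≡⟨ addVertex-edgeCount (pendant W) firstTwo ⟩
  count (firstTwo {twice j}) + edgeCount (pendant W)
    ≡⟨ cong₂ _+_ (count-firstTwo (twice j)) (addVertex-edgeCount W first) ⟩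
  2 + (count (first {twice j}) + edgeCount W)
    ≡⟨ cong (2 +_) (cong₂ _+_ (count-first (twice j)) (triangleChain-edges j)) ⟩
  3 + 3 * j
    ≡⟨ sym (*-suc 3 j) ⟩
  3 * suc j
    ∎
  where
  open ≡-Reasoning
  W : Graph (suc (twice j))
  W = triangleChain j

Extremal : ∀ {n} → Graph n → Set
Extremal {n} G = Connected G × DenseStar 3 G × edgeCount G ≡ ceil3half n

extremal : ∀ {k} (G : Graph (suc (suc k))) → Connected G → Triangular G → ¬ Dense 4 G →
  3 * suc k ≤ edgeCount G + edgeCount G → edgeCount G + edgeCount G ≤ 3 * suc k + 1 → Extremal G
extremal {k} G conn tri not4 lower upper =
  conn , (triangular⇒dense G conn tri , not4) , sym (ceil3half-exact {suc k} lower upper)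

-- C_{j+1} has 2j + 3 vertices and 3(j + 1) edges.
triangleChain-extremal : ∀ j → Extremal (triangleChain (suc j))
triangleChain-extremal j =
  extremal (triangleChain (suc j)) (triangleChain-connected (suc j)) (triangleChain-triangular (suc j))
    (ear-not-4-dense _) (≤-reflexive 3m≡2e) (≤-trans (≤-reflexive (sym 3m≡2e)) (m≤m+n _ 1))
  where
  open ≡-Reasoning
  3m≡2e : 3 * twice (suc j) ≡ edgeCount (triangleChain (suc j)) + edgeCount (triangleChain (suc j))
  3m≡2e = begin
    3 * twice (suc j)       ≡⟨ cong (3 *_) (twice≡+ (suc j)) ⟩
    3 * (suc j + suc j)     ≡⟨ *-distribˡ-+ 3 (suc j) (suc j) ⟩
    3 * suc j + 3 * suc j   ≡⟨ sym (cong₂ _+_ (triangleChain-edges (suc j)) (triangleChain-edges (suc j))) ⟩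
    edgeCount (triangleChain (suc j)) + edgeCount (triangleChain (suc j)) ∎

-- C_{j+1} plus an ear has 2j + 4 vertices and 3(j + 1) + 2 edges.
ear-triangleChain-extremal : ∀ j → Extremal (ear (triangleChain (suc j)))
ear-triangleChain-extremal j =
  extremal G (addVertex-connected _ firstTwo {fz} (triangleChain-connected (suc j)) tt) triangular
    (ear-not-4-dense _) (≤-trans (m≤m+n _ 1) (≤-reflexive 3m+1≡2e)) (≤-reflexive (sym 3m+1≡2e))
  where
  G : Graph (suc (suc (suc (suc (twice j)))))
  G = ear (triangleChain (suc j))
  open ≡-Reasoning
  triangular : Triangular G
  triangular = addVertex-triangular _ firstTwo (λ u v uv → inj₁ (triangleChain-triangular (suc j) u v uv))
                                    (firstTwo-closed (triangleChain (suc j)) tt)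
  arithmetic : ∀ i → 3 * (3 + (i + i)) + 1 ≡ (2 + 3 * suc i) + (2 + 3 * suc i)
  arithmetic = solve-∀
  3m+1≡2e : 3 * suc (suc (suc (twice j))) + 1 ≡ edgeCount G + edgeCount G
  3m+1≡2e = begin
    3 * (3 + twice j) + 1                   ≡⟨ cong (λ t → 3 * (3 + t) + 1) (twice≡+ j) ⟩
    3 * (3 + (j + j)) + 1                   ≡⟨ arithmetic j ⟩
    (2 + 3 * suc j) + (2 + 3 * suc j)       ≡⟨ sym (cong₂ _+_ edges edges) ⟩
    edgeCount G + edgeCount G               ∎
    where
    edges : edgeCount G ≡ 2 + 3 * suc j
    edges = trans (addVertex-edgeCount (triangleChain (suc j)) firstTwo)
                  (cong₂ _+_ (count-firstTwo (suc (twice j))) (triangleChain-edges (suc j)))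

-- Every n ≥ 3 is 2j + 3 or 2j + 4.
extremal-exists : ∀ m → Σ (Graph (3 + m)) Extremal
extremal-exists m with parity m
... | inj₁ (j , refl) = triangleChain (suc j) , triangleChain-extremal j
... | inj₂ (j , refl) = ear (triangleChain (suc j)) , ear-triangleChain-extremal j

theorem4p3 : (n : ℕ) → 3 ≤ n →
    (Σ (Graph n) (λ G → Connected G × DenseStar 3 G × edgeCount G ≡ ceil3half n))
    × ((G : Graph n) → Connected G → DenseStar 3 G → ceil3half n ≤ edgeCount G)
theorem4p3 (suc (suc (suc m))) (s≤s (s≤s (s≤s _))) = extremal-exists m , lower
  where
  lower : (G : Graph (3 + m)) → Connected G → DenseStar 3 G → ceil3half (3 + m) ≤ edgeCount G
  lower G conn (dense , _) =
    ceil3half-≤ {2 + m} (LowerBound.lower-bound G conn (dense⇒triangular G dense))
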